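{- Let $G$ be a $\lambda$-term-graph over $\Sigma^\lambda_{12}$, let $G'$ be an arbitrary term graph over $\Sigma^\lambda_{12}$, and suppose $h$ is a homomorphism from $G$ to $G'$. Then: (i) If $G$ is fully back-linked, then $G'$ is also a $\lambda$-term-graph over $\Sigma^\lambda_{12}$, and $G'$ is fully back-linked. (ii) If $G$ is eager-scope, then $G'$ is also a $\lambda$-term-graph over $\Sigma^\lambda_{12}$, and $G'$ is eager-scope.
   Context: Term graphs. Let $\Sigma$ be a set of function symbols, each with an arity $\mathrm{ar}$. A term graph over $\Sigma$ is a tuple $G=(V,\mathit{lab},\mathit{args},r)$, where: - $V$ is a (possibly infinite) set of vertices; - $\mathit{lab}:V\to\Sigma$ is the labelling; - $\mathit{args}:V\to V^*$ satisfies $|\mathit{args}(v)|=\mathrm{ar}(\mathit{lab}(v))$; - $r\in V$ is the root, and every vertex is reachable from $r$. For $k\in\mathbb N$ write $w\rightarrowtail_k w'$ if $w'$ is the $k$-th entry (counting from $0$) of $\mathit{args}(w)$. Write $w\rightarrowtail w'$ if $w\rightarrowtail_k w'$ for some $k$. Homomorphisms. A homomorphism from $G_1$ to $G_2$ is a map $h:V_1\to V_2$ such that: - $h(r_1)=r_2$; - $\mathit{lab}_2(h(v))=\mathit{lab}_1(v)$; - $\mathit{args}_2(h(v))=\bar h(\mathit{args}_1(v))$ for all $v$, where $\bar h$ applies $h$ letterwise to words. Words. For words over $V$: juxtaposition is concatenation, $\epsilon$ is the empty word, and $\le$ is the prefix order. Signature. $\Sigma^\lambda_{ij}=\{@,\lambda,0,S\}$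 with $\mathrm{ar}(@)=2$, $\mathrm{ar}(\lambda)=1$, $\mathrm{ar}(0)=i$, $\mathrm{ar}(S)=j$, for $i\in\{0,1\}$, $j\in\{1,2\}$. $V(f)$ denotes the set of vertices labelled $f$. Abstraction-prefix functions. For a term graph $G$ over $\Sigma^\lambda_{ij}$, a map $P:V\to V^*$ is a correct abstraction-prefix function if, for all vertices $w,w_0,w_1$ and $k\in\{0,1\}$: - $P(r)=\epsilon$; - if $\mathit{lab}(w)=\lambda$ and $w\rightarrowtail_0 w_0$, then $P(w_0)=P(w)w$; - if $\mathit{lab}(w)=@$ and $w\rightarrowtail_k w_k$, then $P(w_k)=P(w)$; - if $\mathit{lab}(w)=0$, then $P(w)\neq\epsilon$; - if $\mathit{lab}(w)=0$ and $w\rightarrowtail_0 w_0$, then $\mathit{lab}(w_0)=\lambda$ and $P(w_0)w_0=P(w)$; - if $\mathit{lab}(w)=S$ and $w\rightarrowtail_0 w_0$, then $P(w_0)v=P(w)$ for some vertex $v$; - if $\mathit{lab}(w)=S$ and $w\rightarrowtail_1 w_1$, then $\mathit{lab}(w_1)=\lambda$ and $P(w_1)w_1=P(w)$. A $\lambda$-term-graph over $\Sigma^\lambda_{ij}$ is a term graph over $\Sigma^\lambda_{ij}$ that admits a correct abstraction-prefix function. Such a function is then unique, and is called the abstraction-prefix function $P$ of $G$. Eager-scope. A $\lambda$-term-graph $G$ over $\Sigma^\lambda_{1j}$ is eager-scope if: for all $w,v\in V$ and $p\in V^*$ with $P(w)=pv$ and $\mathit{lab}(w)\ne S$, there exist $n\in\mathbb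 N$ and vertices $w=w_0\rightarrowtail w_1\rightarrowtail\cdots\rightarrowtail w_n\rightarrowtail_0 v$ with $\mathit{lab}(w_n)=0$ and $pv\le P(w_i)$ for all $1\le i\le n-1$. Fully back-linked. $G$ is fully back-linked if: for all $w,v\in V$, $p\in V^*$ with $P(w)=pv$, there exist $n$ and $w=w_0\rightarrowtail w_1\rightarrowtail\cdots\rightarrowtail w_n\rightarrowtail v$ with $pv\le P(w_i)$ for all $0\le i\le n$. -}

module Defs where

open import Data.Nat using (ℕ; zero; suc)
open import Data.List using (List; []; _∷_; _++_; length; map)
open import Data.Maybe using (Maybe; just; nothing)
open import Data.Product using (Σ; ∃; _×_; _,_)
open import Data.Sum using (_⊎_)
open import Relation.Binary.PropositionalEquality using (_≡_)
open import Relation.Nullary using (¬_)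
open import Relation.Binary.Construct.Closure.ReflexiveTransitive using (Star)

data Sym : Set where
  app lam zer succ : Sym

ar : Sym → ℕ
ar app  = 2
ar lam  = 1
ar zer  = 1
ar succ = 2

_!!_ : {A : Set} → List A → ℕ → Maybe A
[]       !! _     = nothing
(x ∷ xs) !! zero  = just x
(x ∷ xs) !! suc k = xs !! k

_≼_ : {A : Set} → List A → List A → Set
p ≼ q = ∃ λ r → p ++ r ≡ q

record TermGraph : Set₁ where
  field
    V     : Set
    lab   : V → Sym
    args  : V → List V
    arity : (v : V) → length (args v) ≡ ar (lab v)
    root  : V

  Edge : V → ℕ → V → Set
  Edge w k w' = args w !! k ≡ just w'

  _↣_ : V → V → Set
  w ↣ w' = ∃ λ k → Edge w k w'

  field
    reachable : (v : V) → Star _↣_ root v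

open TermGraph public

record Hom (G₁ G₂ : TermGraph) : Set where
  field
    fun      : V G₁ → V G₂
    pres-root : fun (root G₁) ≡ root G₂
    pres-lab  : (v : V G₁) → lab G₂ (fun v) ≡ lab G₁ v
    pres-args : (v : V G₁) → args G₂ (fun v) ≡ map fun (args G₁ v)

module _ (G : TermGraph) where
  private
    W = V G

  record CorrectAPF (P : W → List W) : Set where
    field
      root-ε  : P (root G) ≡ []
      lam-ok  : ∀ w w₀ → lab G w ≡ lam → Edge G w 0 w₀ → P w₀ ≡ P w ++ (w ∷ [])
      app-ok  : ∀ w k wk → lab G w ≡ app → (k ≡ 0 ⊎ k ≡ 1) → Edge G w k wk → P wk ≡ P w
      zer-ne  : ∀ w → lab G w ≡ zer → ¬ (P w ≡ [])
      zer-ok  : ∀ w w₀ → lab G w ≡ zer → Edge G w 0 w₀ →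
                  (lab G w₀ ≡ lam) × (P w₀ ++ (w₀ ∷ []) ≡ P w)
      succ-0  : ∀ w w₀ → lab G w ≡ succ → Edge G w 0 w₀ →
                  ∃ λ v → P w₀ ++ (v ∷ []) ≡ P w
      succ-1  : ∀ w w₁ → lab G w ≡ succ → Edge G w 1 w₁ →
                  (lab G w₁ ≡ lam) × (P w₁ ++ (w₁ ∷ []) ≡ P w)

  IsLambdaTermGraph : Set
  IsLambdaTermGraph = Σ (W → List W) CorrectAPF

  module Paths (P : W → List W) (q : List W) (v : W) where
    -- tails w_i ↣ … ↣ w_n ↣_0 v (1 ≤ i), where lab(w_n)=0 and q ≤ P(w_j) for i ≤ j ≤ n-1
    data EagerTail : W → Set where
      end : ∀ {u} → lab G u ≡ zer → Edge G u 0 v → EagerTail u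
      mid : ∀ {u u'} → q ≼ P u → _↣_ G u u' → EagerTail u' → EagerTail u

    -- paths w = w_0 ↣ … ↣ w_n ↣_0 v with lab(w_n)=0 and q ≤ P(w_i) for 1 ≤ i ≤ n-1
    EagerPath : W → Set
    EagerPath w = ((lab G w ≡ zer) × Edge G w 0 v)
                  ⊎ (∃ λ u → _↣_ G w u × EagerTail u)

    data BackPath : W → Set where
      end : ∀ {u} → q ≼ P u → _↣_ G u v → BackPath u
      mid : ∀ {u u'} → q ≼ P u → _↣_ G u u' → BackPath u' → BackPath u

  EagerScopeWrt : (W → List W) → Set
  EagerScopeWrt P = ∀ w v (p : List W) → P w ≡ p ++ (v ∷ []) → ¬ (lab G w ≡ succ) →
                    Paths.EagerPath P (p ++ (v ∷ [])) v w

  FullyBackLinkedWrt : (W → List W) → Set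
  FullyBackLinkedWrt P = ∀ w v (p : List W) → P w ≡ p ++ (v ∷ []) →
                         Paths.BackPath P (p ++ (v ∷ [])) v w

  EagerScopeLTG : Set
  EagerScopeLTG = Σ (W → List W) λ P → CorrectAPF P × EagerScopeWrt P

  FullyBackLinkedLTG : Set
  FullyBackLinkedLTG = Σ (W → List W) λ P → CorrectAPF P × FullyBackLinkedWrt P

module Submission where

-- Set P′ (h w) := map h (P w). Everything hinges on this being well defined, i.e. on
-- h w₁ ≡ h w₂ implying map h (P w₁) ≡ map h (P w₂). If P w₁ = p v, full back-linkedness
-- gives a path from w₁ to v inside the scope of v. Since h preserves labels and arguments,
-- the same path can be followed from w₂, and along it the prefixes on both sides grow and
-- shrink in lockstep. The last edge leaves the scope of v, so it starts at a 0- or S-vertex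
-- binding v; its partner on the w₂ side then shows that P w₂ = P x x with h x = h v, and
-- induction on the length of P w₁ concludes. Eager-scope graphs are fully back-linked, and
-- back-link and eager-scope paths map along h, so both properties pass to G′.

open import Defs
open import Data.Empty using (⊥-elim)
open import Data.List using (List; []; _∷_; _++_; _∷ʳ_; [_]; length; map)
open import Data.List.Properties using (++-assoc; ++-conicalʳ; ++-identityʳ; ∷-injectiveʳ; ∷ʳ-injective; ∷ʳ-injectiveʳ; ∷ʳ-++; map-++)
open import Data.List.Reverse using (Reverse; []; _∶_∶ʳ_; reverseView)
open import Data.Maybe using (just)
open import Data.Nat using (ℕ; zero; suc; _<_; s≤s; z≤n)
open import Data.Product using (∃; ∃₂; _×_; _,_; proj₁; proj₂)
open import Data.Sum using (_⊎_; inj₁; inj₂)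
open import Relation.Binary.PropositionalEquality hiding ([_])
open import Relation.Binary.Construct.Closure.ReflexiveTransitive using (Star; ε; _◅_)
open import Relation.Nullary using (¬_; Dec; yes; no)

module _ {A : Set} where

  !!-< : ∀ (xs : List A) k {y} → xs !! k ≡ just y → k < length xs
  !!-< []       _       ()
  !!-< (x ∷ xs) zero    _ = s≤s z≤n
  !!-< (x ∷ xs) (suc k) e = s≤s (!!-< xs k e)

  <-!! : ∀ (xs : List A) k → k < length xs → ∃ λ y → xs !! k ≡ just y
  <-!! []       _       ()
  <-!! (x ∷ xs) zero    _        = x , refl
  <-!! (x ∷ xs) (suc k) (s≤s k<) = <-!! xs k k<

  ∷ʳ-≢-[] : ∀ (xs : List A) {a} → ¬ xs ∷ʳ a ≡ []
  ∷ʳ-≢-[] []      ()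
  ∷ʳ-≢-[] (_ ∷ _) ()

  ≡⇒≼ : ∀ {xs ys : List A} → xs ≡ ys → xs ≼ ys
  ≡⇒≼ {xs} eq = [] , trans (++-identityʳ xs) eq

  ++-∷-⋠ : ∀ (xs : List A) {a ys} → ¬ (xs ++ a ∷ ys) ≼ xs
  ++-∷-⋠ []       (_ , ())
  ++-∷-⋠ (x ∷ xs) (r , eq) = ++-∷-⋠ xs (r , ∷-injectiveʳ eq)

  ∷ʳ-≼-∷ʳ : ∀ (xs : List A) {a b} → (xs ∷ʳ a) ≼ (xs ∷ʳ b) → a ≡ b
  ∷ʳ-≼-∷ʳ []       (_ , refl) = refl
  ∷ʳ-≼-∷ʳ (x ∷ xs) (r , eq)   = ∷ʳ-≼-∷ʳ xs (r , ∷-injectiveʳ eq)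

  snoc-view : ∀ (xs : List A) → xs ≡ [] ⊎ ∃₂ λ p v → xs ≡ p ∷ʳ v
  snoc-view xs with reverseView xs
  ... | []          = inj₁ refl
  ... | p ∶ _ ∶ʳ v = inj₂ (p , v , refl)

  ∷ʳ-infix : ∀ (p : List A) {v r xs y} → p ++ v ∷ r ≡ xs ∷ʳ y →
             (p ≡ xs × v ≡ y) ⊎ ∃ λ r′ → p ++ v ∷ r′ ≡ xs
  ∷ʳ-infix p {v} {r} {xs} eq with reverseView r
  ... | []           = inj₁ (∷ʳ-injective p xs eq)
  ... | r′ ∶ _ ∶ʳ c = inj₂ (r′ , proj₁ (∷ʳ-injective (p ++ v ∷ r′) xs (trans (++-assoc p (v ∷ r′) [ c ]) eq)))

module _ {A B : Set} (f : A → B) where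

  !!-map⁺ : ∀ (xs : List A) k {a} → xs !! k ≡ just a → map f xs !! k ≡ just (f a)
  !!-map⁺ []       _       ()
  !!-map⁺ (x ∷ xs) zero    refl = refl
  !!-map⁺ (x ∷ xs) (suc k) e    = !!-map⁺ xs k e

  !!-map⁻ : ∀ (xs : List A) k {b} → map f xs !! k ≡ just b → ∃ λ a → xs !! k ≡ just a × f a ≡ b
  !!-map⁻ []       _       ()
  !!-map⁻ (x ∷ xs) zero    refl = x , refl , refl
  !!-map⁻ (x ∷ xs) (suc k) e    = !!-map⁻ xs k e

  map-≡-[] : ∀ (xs : List A) → map f xs ≡ [] → xs ≡ []
  map-≡-[] []      _  = refl
  map-≡-[] (_ ∷ _) ()

  map-≡-∷ʳ : ∀ (xs : List A) {ys y} → map f xs ≡ ys ∷ʳ y →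
             ∃₂ λ xs′ x → xs ≡ xs′ ∷ʳ x × map f xs′ ≡ ys × f x ≡ y
  map-≡-∷ʳ xs {ys} eq with reverseView xs
  ... | []            = ⊥-elim (∷ʳ-≢-[] ys (sym eq))
  ... | xs′ ∶ _ ∶ʳ x with eq₁ , eq₂ ← ∷ʳ-injective _ ys (trans (sym (map-++ f xs′ [ x ])) eq)
    = xs′ , x , refl , eq₁ , eq₂

data Shape : Set where
  keep push pop : Shape

Step : {A : Set} → Shape → A → List A → List A → Set
Step keep _ xs ys = ys ≡ xs
Step push a xs ys = ys ≡ xs ∷ʳ a
Step pop  _ xs ys = ∃ λ b → ys ∷ʳ b ≡ xs

module _ {A : Set} where

  data Aligned (q s : List A) : List A → List A → Set where
    base : Aligned q s q s
    grow : ∀ {xs ys a b} → Aligned q s xs ys → Aligned q s (xs ∷ʳ a) (ys ∷ʳ b)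

  aligned-≼ : ∀ {q s xs ys} → Aligned q s xs ys → q ≼ xs
  aligned-≼ base = ≡⇒≼ refl
  aligned-≼ {q} (grow {a = a} al) with r , eq ← aligned-≼ al =
    r ∷ʳ a , trans (sym (++-assoc q r [ a ])) (cong (_∷ʳ a) eq)

  aligned-start : ∀ {q s xs ys} → Aligned q s xs ys → xs ≡ q → ys ≡ s
  aligned-start base       _    = refl
  aligned-start (grow al) refl = ⊥-elim (++-∷-⋠ _ (aligned-≼ al))

  aligned-step : ∀ σ {q s xs ys xs′ ys′} {a b : A} → Step σ a xs xs′ → Step σ b ys ys′ →
                 q ≼ xs′ → Aligned q s xs ys → Aligned q s xs′ ys′
  aligned-step keep refl refl _ al = al
  aligned-step push refl refl _ al = grow al
  aligned-step pop (_ , eq) _ q≼ base = ⊥-elim (++-∷-⋠ _ (subst (_≼ _) (sym eq) q≼))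
  aligned-step pop (_ , eq) (_ , eq′) _ (grow al)
    with refl , _ ← ∷ʳ-injective _ _ eq | refl , _ ← ∷ʳ-injective _ _ eq′ = al

shape : Sym → Shape
shape app  = keep
shape lam  = push
shape zer  = pop
shape succ = pop

-- The argument of a 0- or S-vertex pointing to the λ it is bound by.
binderArg : Sym → ℕ
binderArg succ = 1
binderArg _    = 0

succ? : (s : Sym) → Dec (s ≡ succ)
succ? app  = no λ ()
succ? lam  = no λ ()
succ? zer  = no λ ()
succ? succ = yes refl

edge-index< : ∀ G {u k u′} → Edge G u k u′ → k < ar (lab G u)
edge-index< G {u} {k} e = subst (k <_) (arity G u) (!!-< (args G u) k e)

edge-exists : ∀ G u {k} → k < ar (lab G u) → ∃ (Edge G u k)
edge-exists G u {k} k< = <-!! (args G u) k (subst (k <_) (sym (arity G u)) k<)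

module Homomorphism {G G′ : TermGraph} (H : Hom G G′) where
  open Hom H renaming (fun to h)

  lab-reflect : ∀ {w s} → lab G′ (h w) ≡ s → lab G w ≡ s
  lab-reflect {w} l = trans (sym (pres-lab w)) l

  lab-fibre : ∀ {u u₂} → h u ≡ h u₂ → lab G u ≡ lab G u₂
  lab-fibre {u} hu = lab-reflect (trans (cong (lab G′) hu) (pres-lab _))

  edge-image : ∀ {u k u′} → Edge G u k u′ → Edge G′ (h u) k (h u′)
  edge-image {u} {k} e = trans (cong (_!! k) (pres-args u)) (!!-map⁺ h (args G u) k e)

  ↣-image : ∀ {u u′} → _↣_ G u u′ → _↣_ G′ (h u) (h u′)
  ↣-image (k , e) = k , edge-image e

  edge-lift : ∀ {u k y} → Edge G′ (h u) k y → ∃ λ u′ → Edge G u k u′ × h u′ ≡ y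
  edge-lift {u} {k} e = !!-map⁻ h (args G u) k (trans (cong (_!! k) (sym (pres-args u))) e)

  edge-lift-fibre : ∀ {u u₂ k u′} → h u ≡ h u₂ → Edge G u k u′ →
                    ∃ λ u₂′ → Edge G u₂ k u₂′ × h u₂′ ≡ h u′
  edge-lift-fibre {k = k} {u′} hu e = edge-lift (subst (λ z → Edge G′ z k (h u′)) hu (edge-image e))

  surjective : ∀ w′ → ∃ λ w → h w ≡ w′
  surjective w′ = go (reachable G′ w′) (root G , pres-root)
    where
    go : ∀ {a b} → Star (_↣_ G′) a b → ∃ (λ w → h w ≡ a) → ∃ λ w → h w ≡ b
    go ε             pre          = pre
    go ((_ , e) ◅ es) (w , refl) with w′ , _ , hw′ ← edge-lift e = go es (w′ , hw′)

  image-ind : ∀ {Q : V G′ → Set} → (∀ w → Q (h w)) → ∀ w′ → Q w′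
  image-ind {Q} f w′ = subst Q (proj₂ (surjective w′)) (f (proj₁ (surjective w′)))

  edge-surjective : ∀ {w′ k y} → Edge G′ w′ k y → ∃₂ λ w x → Edge G w k x × h w ≡ w′ × h x ≡ y
  edge-surjective {w′} e with w , refl ← surjective w′ with x , e₀ , hx ← edge-lift e =
    w , x , e₀ , refl , hx

module AbstractionPrefix {G : TermGraph} {P : V G → List (V G)} (C : CorrectAPF G P) where
  open CorrectAPF C
  open Paths G P

  edge-shape : ∀ {u k u′} → Edge G u k u′ → Step (shape (lab G u)) u (P u) (P u′)
  edge-shape {u} {k} {u′} e with lab G u in l | edge-index< G e
  edge-shape {u} {0} {u′} e | app  | _ = app-ok u 0 u′ l (inj₁ refl) e
  edge-shape {u} {1} {u′} e | app  | _ = app-ok u 1 u′ l (inj₂ refl) e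
  edge-shape {u} {0} {u′} e | lam  | _ = lam-ok u u′ l e
  edge-shape {u} {0} {u′} e | zer  | _ = u′ , proj₂ (zer-ok u u′ l e)
  edge-shape {u} {0} {u′} e | succ | _ = succ-0 u u′ l e
  edge-shape {u} {1} {u′} e | succ | _ = u′ , proj₂ (succ-1 u u′ l e)
  edge-shape {k = suc (suc _)} e | app  | s≤s (s≤s ())
  edge-shape {k = suc _}       e | lam  | s≤s ()
  edge-shape {k = suc _}       e | zer  | s≤s ()
  edge-shape {k = suc (suc _)} e | succ | s≤s (s≤s ())

  binder : ∀ {u s} → lab G u ≡ s → shape s ≡ pop → ∃ (Edge G u (binderArg s))
  binder {u} {zer}  l _ = edge-exists G u (subst (λ s → 0 < ar s) (sym l) (s≤s z≤n))
  binder {u} {succ} l _ = edge-exists G u (subst (λ s → 1 < ar s) (sym l) (s≤s (s≤s z≤n)))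

  binds : ∀ {u s b} → lab G u ≡ s → shape s ≡ pop → Edge G u (binderArg s) b → P b ∷ʳ b ≡ P u
  binds {u} {zer}  {b} l _ e = proj₂ (zer-ok u b l e)
  binds {u} {succ} {b} l _ e = proj₂ (succ-1 u b l e)

  Coherent : V G → Set
  Coherent w = ∀ p v r → P w ≡ p ++ v ∷ r → P v ≡ p

  coherent-step : ∀ {u u′} → _↣_ G u u′ → Coherent u → Coherent u′
  coherent-step {u} (_ , e) c p v r eq with shape (lab G u) | edge-shape e
  ... | keep | eq′ = c p v r (trans (sym eq′) eq)
  ... | push | eq′ with ∷ʳ-infix p (trans (sym eq) eq′)
  ...   | inj₁ (refl , refl) = refl
  ...   | inj₂ (r′ , eq″)    = c p v r′ (sym eq″)
  coherent-step (_ , e) c p v r eq | pop | b , eq′ =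
    c p v (r ∷ʳ b) (trans (sym eq′) (trans (cong (_∷ʳ b) eq) (++-assoc p (v ∷ r) [ b ])))

  coherent : ∀ w → Coherent w
  coherent w = go (reachable G w) at-root
    where
    at-root : Coherent (root G)
    at-root p v r eq with () ← ++-conicalʳ p (v ∷ r) (trans (sym eq) root-ε)

    go : ∀ {a b} → Star (_↣_ G) a b → Coherent a → Coherent b
    go ε        c = c
    go (e ◅ es) c = go es (coherent-step e c)

  backPath-≼ : ∀ {q v u} → BackPath q v u → q ≼ P u
  backPath-≼ (end q≼ _)   = q≼
  backPath-≼ (mid q≼ _ _) = q≼

  closing-edge : ∀ {u k v} → (P v ∷ʳ v) ≼ P u → Edge G u k v → shape (lab G u) ≡ pop × P u ≡ P v ∷ʳ v
  closing-edge {u} {v = v} q≼ e with shape (lab G u) | edge-shape e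
  ... | keep | eq = ⊥-elim (++-∷-⋠ (P v) (subst ((P v ∷ʳ v) ≼_) (sym eq) q≼))
  ... | push | eq =
    ⊥-elim (++-∷-⋠ (P u) (subst (_≼ P u) (∷ʳ-++ (P u) u [ v ]) (subst (λ z → (z ∷ʳ v) ≼ P u) eq q≼)))
  ... | pop  | b , eq with refl ← ∷ʳ-≼-∷ʳ (P v) (subst ((P v ∷ʳ v) ≼_) (sym eq) q≼) = refl , sym eq

  eagerScope⇒fullyBackLinked : EagerScopeWrt G P → FullyBackLinkedWrt G P
  eagerScope⇒fullyBackLinked E w v p eq with succ? (lab G w)
  ... | yes l with z , ez ← binder l refl
              with refl ← ∷ʳ-injectiveʳ (P z) p (trans (binds l refl ez) eq) = end (≡⇒≼ (sym eq)) (1 , ez)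
  ... | no ¬succ with E w v p eq ¬succ
  ...   | inj₁ (_ , e)        = end (≡⇒≼ (sym eq)) (0 , e)
  ...   | inj₂ (_ , a , tail) = mid (≡⇒≼ (sym eq)) a (tail⇒path tail)
    where
    tail⇒path : ∀ {u} → EagerTail (p ∷ʳ v) v u → BackPath (p ∷ʳ v) v u
    tail⇒path {u} (end l e) with refl ← coherent w p v [] eq = end (≡⇒≼ (proj₂ (zer-ok u v l e))) (0 , e)
    tail⇒path (mid q≼ a t) = mid q≼ a (tail⇒path t)

module Transfer {G G′ : TermGraph} (H : Hom G G′) {P : V G → List (V G)} (C : CorrectAPF G P)
                (F : FullyBackLinkedWrt G P) where
  open Hom H renaming (fun to h)
  open Homomorphism H
  open CorrectAPF C
  open AbstractionPrefix C
  open Paths G P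

  walk : ∀ {v u u₂ s} → BackPath (P v ∷ʳ v) v u → h u ≡ h u₂ → Aligned (P v ∷ʳ v) s (P u) (P u₂) →
         ∃ λ x → P x ∷ʳ x ≡ s × h x ≡ h v
  walk {v} (end q≼ (_ , e)) hu al
    with pops , Pu≡q ← closing-edge q≼ e
    with z , ez ← binder refl pops
    with refl ← ∷ʳ-injectiveʳ (P z) (P v) (trans (binds refl pops ez) Pu≡q)
    with x , ex , hx ← edge-lift-fibre hu ez =
    x , trans (binds (sym (lab-fibre hu)) pops ex) (aligned-start al Pu≡q) , hx
  walk {u = u} {u₂} (mid _ (_ , e) path) hu al with u₂′ , e₂ , hu′ ← edge-lift-fibre hu e =
    walk path (sym hu′) (aligned-step (shape (lab G u)) (edge-shape e) step₂ (backPath-≼ path) al)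
    where
    step₂ : Step (shape (lab G u)) u₂ (P u₂) (P u₂′)
    step₂ = subst (λ s → Step (shape s) u₂ (P u₂) (P u₂′)) (sym (lab-fibre hu)) (edge-shape e₂)

  last-entry-fibre : ∀ {w₁ w₂ p v} → h w₁ ≡ h w₂ → P w₁ ≡ p ∷ʳ v → ∃ λ x → P x ∷ʳ x ≡ P w₂ × h x ≡ h v
  last-entry-fibre {w₁} {w₂} {p} {v} hw eq with refl ← coherent w₁ p v [] eq =
    walk (F w₁ v p eq) hw (subst (λ xs → Aligned (P v ∷ʳ v) (P w₂) xs (P w₂)) (sym eq) base)

  map-P-fibre : ∀ {w₁ w₂} → h w₁ ≡ h w₂ → map h (P w₁) ≡ map h (P w₂)
  map-P-fibre {w₁} hw = go (reverseView (P w₁)) refl hw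
    where
    go : ∀ {xs w₁ w₂} → Reverse xs → P w₁ ≡ xs → h w₁ ≡ h w₂ → map h (P w₁) ≡ map h (P w₂)
    go {w₂ = w₂} [] eq₁ hw with snoc-view (P w₂)
    ... | inj₁ eq₂             = cong (map h) (trans eq₁ (sym eq₂))
    ... | inj₂ (_ , _ , eq₂) with x , eq , _ ← last-entry-fibre (sym hw) eq₂ =
      ⊥-elim (∷ʳ-≢-[] (P x) (trans eq eq₁))
    go {w₁ = w₁} {w₂} (p ∶ rp ∶ʳ v) eq₁ hw
      with refl ← coherent w₁ p v [] eq₁
      with x , eq₂ , hx ← last-entry-fibre hw eq₁ = begin
        map h (P w₁)        ≡⟨ cong (map h) eq₁ ⟩
        map h (P v ∷ʳ v)    ≡⟨ map-++ h (P v) [ v ] ⟩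
        map h (P v) ∷ʳ h v  ≡⟨ cong₂ _∷ʳ_ (go rp refl (sym hx)) (sym hx) ⟩
        map h (P x) ∷ʳ h x  ≡⟨ map-++ h (P x) [ x ] ⟨
        map h (P x ∷ʳ x)    ≡⟨ cong (map h) eq₂ ⟩
        map h (P w₂)        ∎
      where open ≡-Reasoning

  P′ : V G′ → List (V G′)
  P′ w′ = map h (P (proj₁ (surjective w′)))

  P′∘h : ∀ w → P′ (h w) ≡ map h (P w)
  P′∘h w = map-P-fibre (proj₂ (surjective (h w)))

  P′-∷ʳ : ∀ {x y w} → P x ∷ʳ y ≡ P w → P′ (h x) ∷ʳ h y ≡ P′ (h w)
  P′-∷ʳ {x} {y} {w} eq = begin
    P′ (h x) ∷ʳ h y     ≡⟨ cong (_∷ʳ h y) (P′∘h x) ⟩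
    map h (P x) ∷ʳ h y  ≡⟨ map-++ h (P x) [ y ] ⟨
    map h (P x ∷ʳ y)    ≡⟨ cong (map h) eq ⟩
    map h (P w)         ≡⟨ P′∘h w ⟨
    P′ (h w)            ∎
    where open ≡-Reasoning

  correct : CorrectAPF G′ P′
  correct = record
    { root-ε = trans (cong P′ (sym pres-root)) (trans (P′∘h (root G)) (cong (map h) root-ε))
    ; lam-ok = λ _ _ l e → case-lam l (edge-surjective e)
    ; app-ok = λ _ _ _ l k e → case-app l k (edge-surjective e)
    ; zer-ne = zer-ne′
    ; zer-ok = λ _ _ l e → case-zer l (edge-surjective e)
    ; succ-0 = λ _ _ l e → case-succ-0 l (edge-surjective e)
    ; succ-1 = λ _ _ l e → case-succ-1 l (edge-surjective e)
    }
    where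
    Lifted : V G′ → ℕ → V G′ → Set
    Lifted w′ k y = ∃₂ λ w x → Edge G w k x × h w ≡ w′ × h x ≡ y

    case-lam : ∀ {w′ y} → lab G′ w′ ≡ lam → Lifted w′ 0 y → P′ y ≡ P′ w′ ∷ʳ w′
    case-lam l (w , x , e , refl , refl) = sym (P′-∷ʳ (sym (lam-ok w x (lab-reflect l) e)))

    case-app : ∀ {w′ k y} → lab G′ w′ ≡ app → (k ≡ 0 ⊎ k ≡ 1) → Lifted w′ k y → P′ y ≡ P′ w′
    case-app {k = k} l k01 (w , x , e , refl , refl) =
      trans (P′∘h x) (trans (cong (map h) (app-ok w k x (lab-reflect l) k01 e)) (sym (P′∘h w)))

    zer-ne′ : ∀ w′ → lab G′ w′ ≡ zer → ¬ P′ w′ ≡ []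
    zer-ne′ = image-ind λ w l eq → zer-ne w (lab-reflect l) (map-≡-[] h (P w) (trans (sym (P′∘h w)) eq))

    case-zer : ∀ {w′ y} → lab G′ w′ ≡ zer → Lifted w′ 0 y → (lab G′ y ≡ lam) × (P′ y ∷ʳ y ≡ P′ w′)
    case-zer l (w , x , e , refl , refl) with lx , eq ← zer-ok w x (lab-reflect l) e =
      trans (pres-lab x) lx , P′-∷ʳ eq

    case-succ-0 : ∀ {w′ y} → lab G′ w′ ≡ succ → Lifted w′ 0 y → ∃ λ v′ → P′ y ∷ʳ v′ ≡ P′ w′
    case-succ-0 l (w , x , e , refl , refl) with b , eq ← succ-0 w x (lab-reflect l) e = h b , P′-∷ʳ eq

    case-succ-1 : ∀ {w′ y} → lab G′ w′ ≡ succ → Lifted w′ 1 y → (lab G′ y ≡ lam) × (P′ y ∷ʳ y ≡ P′ w′)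
    case-succ-1 l (w , x , e , refl , refl) with lx , eq ← succ-1 w x (lab-reflect l) e =
      trans (pres-lab x) lx , P′-∷ʳ eq

  ≼-image : ∀ {q u} → q ≼ P u → map h q ≼ P′ (h u)
  ≼-image {q} {u} (r , eq) = map h r , trans (sym (map-++ h q r)) (trans (cong (map h) eq) (sym (P′∘h u)))

  backPath-image : ∀ {q v u} → BackPath q v u → Paths.BackPath G′ P′ (map h q) (h v) (h u)
  backPath-image (end q≼ a)      = Paths.end (≼-image q≼) (↣-image a)
  backPath-image (mid q≼ a path) = Paths.mid (≼-image q≼) (↣-image a) (backPath-image path)

  eagerTail-image : ∀ {q v u} → EagerTail q v u → Paths.EagerTail G′ P′ (map h q) (h v) (h u)
  eagerTail-image {u = u} (end l e) = Paths.end (trans (pres-lab u) l) (edge-image e)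
  eagerTail-image (mid q≼ a tail) = Paths.mid (≼-image q≼) (↣-image a) (eagerTail-image tail)

  eagerPath-image : ∀ {q v w} → EagerPath q v w → Paths.EagerPath G′ P′ (map h q) (h v) (h w)
  eagerPath-image {w = w} (inj₁ (l , e)) = inj₁ (trans (pres-lab w) l , edge-image e)
  eagerPath-image (inj₂ (u , a , tail)) = inj₂ (h u , ↣-image a , eagerTail-image tail)

  P′-∷ʳ⁻ : ∀ w {p′ v′} → P′ (h w) ≡ p′ ∷ʳ v′ → ∃₂ λ p v → P w ≡ p ∷ʳ v × map h p ≡ p′ × h v ≡ v′
  P′-∷ʳ⁻ w eq = map-≡-∷ʳ h (P w) (trans (sym (P′∘h w)) eq)

  fullyBackLinked : FullyBackLinkedWrt G′ P′
  fullyBackLinked = image-ind at-image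
    where
    at-image : ∀ w v′ p′ → P′ (h w) ≡ p′ ∷ʳ v′ → Paths.BackPath G′ P′ (p′ ∷ʳ v′) v′ (h w)
    at-image w _ _ eq with p , v , eq₀ , refl , refl ← P′-∷ʳ⁻ w eq =
      subst (λ q → Paths.BackPath G′ P′ q (h v) (h w)) (map-++ h p [ v ]) (backPath-image (F w v p eq₀))

  eagerScope : EagerScopeWrt G P → EagerScopeWrt G′ P′
  eagerScope E = image-ind at-image
    where
    at-image : ∀ w v′ p′ → P′ (h w) ≡ p′ ∷ʳ v′ → ¬ lab G′ (h w) ≡ succ →
               Paths.EagerPath G′ P′ (p′ ∷ʳ v′) v′ (h w)
    at-image w _ _ eq ¬succ with p , v , eq₀ , refl , refl ← P′-∷ʳ⁻ w eq =
      subst (λ q → Paths.EagerPath G′ P′ q (h v) (h w)) (map-++ h p [ v ])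
            (eagerPath-image (E w v p eq₀ (λ l → ¬succ (trans (pres-lab w) l))))

theorem7p8 : (G G' : TermGraph) → Hom G G' →
    (FullyBackLinkedLTG G → FullyBackLinkedLTG G') ×
    (EagerScopeLTG G → EagerScopeLTG G')
theorem7p8 G G' H = fullyBackLinked-image , eagerScope-image
  where
  fullyBackLinked-image : FullyBackLinkedLTG G → FullyBackLinkedLTG G'
  fullyBackLinked-image (P , C , F) = T.P′ , T.correct , T.fullyBackLinked
    where module T = Transfer H C F

  eagerScope-image : EagerScopeLTG G → EagerScopeLTG G'
  eagerScope-image (P , C , E) = T.P′ , T.correct , T.eagerScope E
    where module T = Transfer H C (AbstractionPrefix.eagerScope⇒fullyBackLinked C E)
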